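{- Let $n\ge 2$ and let $k$ be an odd positive integer. Then every matrix in $M_n(\mathbb F_2)$ is of the form $A^k+B^k$ with $A,B\in M_n(\mathbb F_2)$. -}

module Defs where

open import Data.Bool using (Bool; true; false; _∧_; _xor_)
open import Data.Nat using (ℕ; zero; suc; _*_)
open import Data.Fin using (Fin)
open import Data.Product using (∃)
open import Relation.Binary.PropositionalEquality using (_≡_)

-- The field F₂ = {0,1} is modelled by Bool: addition is xor, multiplication is ∧.
F₂ : Set
F₂ = Bool

Mat : ℕ → Set
Mat n = Fin n → Fin n → F₂

sumF₂ : ∀ {n} → (Fin n → F₂) → F₂
sumF₂ {zero}  f = false
sumF₂ {suc n} f = f Fin.zero xor sumF₂ (λ j → f (Fin.suc j))

_+ᴹ_ : ∀ {n} → Mat n → Mat n → Mat n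
(A +ᴹ B) i j = A i j xor B i j

_*ᴹ_ : ∀ {n} → Mat n → Mat n → Mat n
(A *ᴹ B) i j = sumF₂ (λ l → A i l ∧ B l j)

Iᴹ : ∀ {n} → Mat n
Iᴹ Fin.zero    Fin.zero    = true
Iᴹ Fin.zero    (Fin.suc j) = false
Iᴹ (Fin.suc i) Fin.zero    = false
Iᴹ (Fin.suc i) (Fin.suc j) = Iᴹ i j

_^ᴹ_ : ∀ {n} → Mat n → ℕ → Mat n
A ^ᴹ zero  = Iᴹ
A ^ᴹ suc k = A *ᴹ (A ^ᴹ k)

OddPos : ℕ → Set
OddPos k = ∃ λ m → k ≡ suc (2 * m)

-- Conjugation preserves being a sum of two k-th powers, as (T A T⁻¹)ᵏ = T Aᵏ T⁻¹. If i ≠ j and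
-- C i i = C j j = C i j = 1, conjugating C by the transvection I + E_ji clears the diagonal entries at i and j
-- and keeps the other ones, so we may assume that no two diagonal ones of C are linked by an off-diagonal one.
-- Ordering the indices with C i i = 1 first, every nonzero off-diagonal entry of C is then strictly above or
-- strictly below the diagonal, and C = (I + U) + (D + L) with U strictly upper, L strictly lower and D the
-- diagonal projection onto the indices with C i i = 0, which carry all nonzero rows of L. Each summand is
-- f + n with f idempotent, f n = n and n f nilpotent; in characteristic two this gives Y^(1 + 2^e) = Y for
-- 2^e > n, and since k is invertible modulo 2^e, Y is the k-th power of a power of itself.
module Submission where

open import Defs
open import Algebra.Bundles using (Semiring; CommutativeRing)
import Algebra.Construct.Pointwise as Pointwise
open import Data.Bool as Bool using (Bool; true; false; _∧_; _xor_; not; if_then_else_)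
open import Data.Bool.Properties
  using (xor-∧-commutativeRing; ∧-assoc; ∧-idem; ∧-zeroʳ; ∧-identityʳ; ∧-conicalˡ; ∧-conicalʳ;
         ∧-distribˡ-xor; ∧-distribʳ-xor; xor-identityʳ; xor-same; ¬-not; ≤-minimum; ≤-maximum; ≤-reflexive)
open import Data.Fin as Fin using (Fin; zero; suc; toℕ)
open import Data.Fin.Properties using (any?; toℕ<n; toℕ-injective)
open import Function using (_∘_)
open import Level using (_⊔_; 0ℓ)
open import Data.Nat as ℕ using (ℕ; zero; suc; _≤_; _<_; _<?_; s≤s; z≤n)
import Data.Nat.Properties as ℕₚ
open import Data.Nat.Tactic.RingSolver using (solve-∀)
open import Data.Product using (∃; ∃₂; _,_; _×_)
open import Relation.Nullary using (¬_; Dec; yes; no; does; contradiction; ¬?; _×-dec_)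
open import Relation.Nullary.Decidable using (dec-true; dec-false)
open import Relation.Binary.Definitions using (tri<; tri≈; tri>)
open import Data.Sum using (_⊎_; inj₁; inj₂)
open import Relation.Binary.PropositionalEquality as ≡ using (_≡_; _≢_; refl; cong; cong₂; module ≡-Reasoning)
open import Tactic.MonoidSolver using (solve)

module _ where
  open import Data.Nat using (_+_; _*_; _^_)
  open import Data.Nat.Properties using (*-distribʳ-+)

  even-or-odd : ∀ t → ∃ λ s → t ≡ 2 * s ⊎ t ≡ suc (2 * s)
  even-or-odd zero = 0 , inj₁ refl
  even-or-odd (suc t) with even-or-odd t
  ... | s , inj₁ refl = s , inj₂ refl
  ... | s , inj₂ refl = suc s , inj₁ (2+2s≡2[1+s] s)
    where 2+2s≡2[1+s] : ∀ s → suc (suc (2 * s)) ≡ 2 * suc s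
          2+2s≡2[1+s] = solve-∀

  -- If j k = 1 + t 2^e with t odd, then (j + 2^e) k = 1 + (t + k) 2^e with t + k even.
  odd-invertible-mod-2^ : ∀ h e → ∃₂ λ j t → j * suc (2 * h) ≡ suc (t * 2 ^ e)
  odd-invertible-mod-2^ h zero = 1 , 2 * h , 1[1+2h]≡1+2h[1] h
    where 1[1+2h]≡1+2h[1] : ∀ h → 1 * suc (2 * h) ≡ suc (2 * h * 1)
          1[1+2h]≡1+2h[1] = solve-∀
  odd-invertible-mod-2^ h (suc e) with odd-invertible-mod-2^ h e
  ... | j , t , jk≡1+t2^e with even-or-odd t
  ...   | s , inj₁ refl = j , s , ≡.trans jk≡1+t2^e (cong suc (2s[m]≡s[2m] s (2 ^ e)))
    where 2s[m]≡s[2m] : ∀ s m → 2 * s * m ≡ s * (2 * m)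
          2s[m]≡s[2m] = solve-∀
  ...   | s , inj₂ refl = j + 2 ^ e , s + h + 1 , corrected
    where
    open ≡-Reasoning
    k : ℕ
    k = suc (2 * h)
    regroup : ∀ s h m → suc (suc (2 * s) * m) + m * suc (2 * h) ≡ suc ((s + h + 1) * (2 * m))
    regroup = solve-∀
    corrected : (j + 2 ^ e) * k ≡ suc ((s + h + 1) * 2 ^ suc e)
    corrected = begin
      (j + 2 ^ e) * k                         ≡⟨ *-distribʳ-+ k j (2 ^ e) ⟩
      j * k + 2 ^ e * k                       ≡⟨ cong (_+ 2 ^ e * k) jk≡1+t2^e ⟩
      suc (suc (2 * s) * 2 ^ e) + 2 ^ e * k   ≡⟨ regroup s h (2 ^ e) ⟩
      suc ((s + h + 1) * 2 ^ suc e)           ∎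

  n<2^n : ∀ n → n < 2 ^ n
  n<2^n zero    = s≤s z≤n
  n<2^n (suc n) = ≡.subst (suc (suc n) ≤_) (cong (2 ^ n +_) (≡.sym (ℕₚ.+-identityʳ (2 ^ n))))
                          (ℕₚ.+-mono-≤ (ℕₚ.m^n>0 2 n) (n<2^n n))

module SemiringPowers {c ℓ} (S : Semiring c ℓ) where
  open Semiring S
  open import Algebra.Properties.Semiring.Exp S
  open import Relation.Binary.Reasoning.Setoid setoid

  SumOfTwoPowers : ℕ → Carrier → Set (c ⊔ ℓ)
  SumOfTwoPowers k z = ∃₂ λ x y → z ≈ x ^ k + y ^ k

  ^-conj : ∀ {p q} → p * q ≈ 1# → q * p ≈ 1# → ∀ x k → (p * x * q) ^ k ≈ p * x ^ k * q
  ^-conj {p} {q} pq≈1 qp≈1 x zero = sym (trans (*-congʳ (*-identityʳ p)) pq≈1)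
  ^-conj {p} {q} pq≈1 qp≈1 x (suc k) = begin
    p * x * q * (p * x * q) ^ k        ≈⟨ *-congˡ (^-conj pq≈1 qp≈1 x k) ⟩
    p * x * q * (p * x ^ k * q)        ≈⟨ solve *-monoid ⟩
    p * (x * (q * p) * x ^ k) * q      ≈⟨ *-congʳ (*-congˡ (*-congʳ (trans (*-congˡ qp≈1) (*-identityʳ x)))) ⟩
    p * (x * x ^ k) * q                ∎

  SumOfTwoPowers-conj : ∀ {p q} → p * q ≈ 1# → q * p ≈ 1# →
    ∀ k z → SumOfTwoPowers k (q * z * p) → SumOfTwoPowers k z
  SumOfTwoPowers-conj {p} {q} pq≈1 qp≈1 k z (x , y , qzp≈) = p * x * q , p * y * q , (begin
    z                                  ≈⟨ solve *-monoid ⟩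
    1# * z * 1#                        ≈⟨ *-cong (*-congʳ (sym pq≈1)) (sym pq≈1) ⟩
    p * q * z * (p * q)                ≈⟨ solve *-monoid ⟩
    p * (q * z * p) * q                ≈⟨ *-congʳ (*-congˡ qzp≈) ⟩
    p * (x ^ k + y ^ k) * q            ≈⟨ trans (*-congʳ (distribˡ p _ _)) (distribʳ q _ _) ⟩
    p * x ^ k * q + p * y ^ k * q      ≈⟨ sym (+-cong (^-conj pq≈1 qp≈1 x k) (^-conj pq≈1 qp≈1 y k)) ⟩
    (p * x * q) ^ k + (p * y * q) ^ k  ∎)

  ^-suc-rotate : ∀ x y p → (x * y) ^ suc p ≈ x * (y * x) ^ p * y
  ^-suc-rotate x y zero = solve *-monoid
  ^-suc-rotate x y (suc p) = begin
    x * y * (x * y) ^ suc p            ≈⟨ *-congˡ (^-suc-rotate x y p) ⟩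
    x * y * (x * (y * x) ^ p * y)      ≈⟨ solve *-monoid ⟩
    x * (y * x * (y * x) ^ p) * y      ∎

  ^-periodic : ∀ {y m} → y ^ suc m ≈ y → ∀ t → y ^ suc (t ℕ.* m) ≈ y
  ^-periodic {y} y^[1+m]≈y zero = *-identityʳ y
  ^-periodic {y} {m} y^[1+m]≈y (suc t) = begin
    y ^ (suc m ℕ.+ t ℕ.* m)    ≈⟨ ^-homo-* y (suc m) (t ℕ.* m) ⟩
    y ^ suc m * y ^ (t ℕ.* m)  ≈⟨ *-congʳ y^[1+m]≈y ⟩
    y ^ suc (t ℕ.* m)          ≈⟨ ^-periodic y^[1+m]≈y t ⟩
    y                          ∎

  odd-root-of-2^-periodic : ∀ {y} e → y ^ suc (2 ℕ.^ e) ≈ y → ∀ k → OddPos k → ∃ λ x → x ^ k ≈ y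
  odd-root-of-2^-periodic {y} e periodic k (h , refl) with odd-invertible-mod-2^ h e
  ... | j , t , jk≡1+t2^e = y ^ j , (begin
    (y ^ j) ^ k              ≈⟨ ^-assocʳ y j k ⟩
    y ^ (j ℕ.* k)            ≡⟨ cong (y ^_) jk≡1+t2^e ⟩
    y ^ suc (t ℕ.* 2 ℕ.^ e)  ≈⟨ ^-periodic periodic t ⟩
    y                        ∎)

  ^-double : ∀ x m → x ^ (2 ℕ.* m) ≈ x ^ m * x ^ m
  ^-double x m = trans (^-congʳ x (cong (m ℕ.+_) (ℕₚ.+-identityʳ m))) (^-homo-* x m m)

  ^-commute : ∀ {x y} → x * y ≈ y * x → ∀ m → x ^ m * y ≈ y * x ^ m
  ^-commute {x} {y} xy≈yx zero = trans (*-identityˡ y) (sym (*-identityʳ y))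
  ^-commute {x} {y} xy≈yx (suc m) = begin
    x * x ^ m * y    ≈⟨ *-assoc x (x ^ m) y ⟩
    x * (x ^ m * y)  ≈⟨ *-congˡ (^-commute xy≈yx m) ⟩
    x * (y * x ^ m)  ≈⟨ sym (*-assoc x y (x ^ m)) ⟩
    x * y * x ^ m    ≈⟨ *-congʳ xy≈yx ⟩
    y * x * x ^ m    ≈⟨ *-assoc y x (x ^ m) ⟩
    y * (x * x ^ m)  ∎

  idempotent-^-2^ : ∀ {f} → f * f ≈ f → ∀ e → f ^ (2 ℕ.^ e) ≈ f
  idempotent-^-2^ {f} ff≈f zero = *-identityʳ f
  idempotent-^-2^ {f} ff≈f (suc e) = begin
    f ^ (2 ℕ.* 2 ℕ.^ e)                  ≈⟨ ^-double f (2 ℕ.^ e) ⟩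
    f ^ (2 ℕ.^ e) * f ^ (2 ℕ.^ e)        ≈⟨ *-cong (idempotent-^-2^ ff≈f e) (idempotent-^-2^ ff≈f e) ⟩
    f * f                                ≈⟨ ff≈f ⟩
    f                                    ∎

CharacteristicTwo : ∀ {c ℓ} → Semiring c ℓ → Set (c ⊔ ℓ)
CharacteristicTwo S = ∀ x → x + x ≈ 0#
  where open Semiring S

module CharacteristicTwoProperties {c ℓ} (S : Semiring c ℓ) (x+x≈0 : CharacteristicTwo S) where
  open Semiring S
  open import Algebra.Properties.Semiring.Exp S
  open import Relation.Binary.Reasoning.Setoid setoid
  open SemiringPowers S using (^-suc-rotate; ^-double; ^-commute; idempotent-^-2^)

  square-of-sum : ∀ {x y} → x * y ≈ y * x → (x + y) * (x + y) ≈ x * x + y * y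
  square-of-sum {x} {y} xy≈yx = begin
    (x + y) * (x + y)                  ≈⟨ trans (distribʳ (x + y) x y) (+-cong (distribˡ x x y) (distribˡ y x y)) ⟩
    (x * x + x * y) + (y * x + y * y)  ≈⟨ +-congʳ (+-congˡ xy≈yx) ⟩
    (x * x + y * x) + (y * x + y * y)  ≈⟨ +-assoc (x * x) (y * x) _ ⟩
    x * x + (y * x + (y * x + y * y))  ≈⟨ +-congˡ (sym (+-assoc (y * x) (y * x) _)) ⟩
    x * x + ((y * x + y * x) + y * y)  ≈⟨ +-congˡ (+-congʳ (x+x≈0 (y * x))) ⟩
    x * x + (0# + y * y)               ≈⟨ +-congˡ (+-identityˡ (y * y)) ⟩
    x * x + y * y                      ∎

  frobenius : ∀ {x y} → x * y ≈ y * x → ∀ e → (x + y) ^ (2 ℕ.^ e) ≈ x ^ (2 ℕ.^ e) + y ^ (2 ℕ.^ e)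
  frobenius {x} {y} xy≈yx zero = trans (*-identityʳ (x + y)) (sym (+-cong (*-identityʳ x) (*-identityʳ y)))
  frobenius {x} {y} xy≈yx (suc e) = begin
    (x + y) ^ (2 ℕ.* m)                  ≈⟨ ^-double (x + y) m ⟩
    (x + y) ^ m * (x + y) ^ m            ≈⟨ *-cong (frobenius xy≈yx e) (frobenius xy≈yx e) ⟩
    (x ^ m + y ^ m) * (x ^ m + y ^ m)    ≈⟨ square-of-sum powers-commute ⟩
    x ^ m * x ^ m + y ^ m * y ^ m        ≈⟨ sym (+-cong (^-double x m) (^-double y m)) ⟩
    x ^ (2 ℕ.* m) + y ^ (2 ℕ.* m)        ∎
    where
    m = 2 ℕ.^ e
    powers-commute : x ^ m * y ^ m ≈ y ^ m * x ^ m
    powers-commute = sym (^-commute (sym (^-commute xy≈yx m)) m)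

  -- With g = 1 + n one has f + n ≈ f g, and g f ≈ f + n f is an idempotent plus a commuting nilpotent.
  idempotent+nilpotent-periodic : ∀ {f n} e → f * f ≈ f → f * n ≈ n → (n * f) ^ (2 ℕ.^ e) ≈ 0# →
    (f + n) ^ suc (2 ℕ.^ e) ≈ f + n
  idempotent+nilpotent-periodic {f} {n} e ff≈f fn≈n nilpotent = begin
    (f + n) ^ suc m                 ≈⟨ ^-congˡ (suc m) f+n≈fg ⟩
    (f * g) ^ suc m                 ≈⟨ ^-suc-rotate f g m ⟩
    f * (g * f) ^ m * g             ≈⟨ *-congʳ (*-congˡ (^-congˡ m gf≈f+nf)) ⟩
    f * (f + n * f) ^ m * g         ≈⟨ *-congʳ (*-congˡ (frobenius f-nf-commute e)) ⟩
    f * (f ^ m + (n * f) ^ m) * g   ≈⟨ *-congʳ (*-congˡ (+-cong (idempotent-^-2^ ff≈f e) nilpotent)) ⟩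
    f * (f + 0#) * g                ≈⟨ *-congʳ (trans (*-congˡ (+-identityʳ f)) ff≈f) ⟩
    f * g                           ≈⟨ sym f+n≈fg ⟩
    f + n                           ∎
    where
    m = 2 ℕ.^ e
    g = 1# + n
    f+n≈fg : f + n ≈ f * g
    f+n≈fg = sym (trans (distribˡ f 1# n) (+-cong (*-identityʳ f) fn≈n))
    gf≈f+nf : g * f ≈ f + n * f
    gf≈f+nf = trans (distribʳ f 1# n) (+-congʳ (*-identityˡ f))
    f-nf-commute : f * (n * f) ≈ n * f * f
    f-nf-commute = begin
      f * (n * f)  ≈⟨ sym (*-assoc f n f) ⟩
      f * n * f    ≈⟨ *-congʳ fn≈n ⟩
      n * f        ≈⟨ *-congˡ (sym ff≈f) ⟩
      n * (f * f)  ≈⟨ sym (*-assoc n f f) ⟩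
      n * f * f    ∎

  square-zero-transvection-involutive : ∀ {x} → x * x ≈ 0# → (1# + x) * (1# + x) ≈ 1#
  square-zero-transvection-involutive {x} xx≈0 = begin
    (1# + x) * (1# + x)            ≈⟨ distribʳ (1# + x) 1# x ⟩
    1# * (1# + x) + x * (1# + x)   ≈⟨ +-cong (*-identityˡ (1# + x)) (distribˡ x 1# x) ⟩
    (1# + x) + (x * 1# + x * x)    ≈⟨ +-congˡ (+-cong (*-identityʳ x) xx≈0) ⟩
    (1# + x) + (x + 0#)            ≈⟨ +-congˡ (+-identityʳ x) ⟩
    (1# + x) + x                   ≈⟨ +-assoc 1# x x ⟩
    1# + (x + x)                   ≈⟨ +-congˡ (x+x≈0 x) ⟩
    1# + 0#                        ≈⟨ +-identityʳ 1# ⟩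
    1#                             ∎

open import Algebra.Properties.Semiring.Sum (CommutativeRing.semiring xor-∧-commutativeRing)
  using (sum; sum-cong-≗; ∑-distrib-+; ∑-comm; *-distribˡ-sum; *-distribʳ-sum)

sumF₂≡sum : ∀ {n} (f : Fin n → F₂) → sumF₂ f ≡ sum f
sumF₂≡sum {zero}  f = refl
sumF₂≡sum {suc n} f = cong (f zero xor_) (sumF₂≡sum (f ∘ suc))

sumF₂-cong : ∀ {n} {f g : Fin n → F₂} → (∀ i → f i ≡ g i) → sumF₂ f ≡ sumF₂ g
sumF₂-cong {zero}  f≗g = refl
sumF₂-cong {suc n} f≗g = cong₂ _xor_ (f≗g zero) (sumF₂-cong (f≗g ∘ suc))

sumF₂-xor : ∀ {n} (f g : Fin n → F₂) → sumF₂ (λ i → f i xor g i) ≡ sumF₂ f xor sumF₂ g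
sumF₂-xor f g = begin
  sumF₂ (λ i → f i xor g i)  ≡⟨ sumF₂≡sum (λ i → f i xor g i) ⟩
  sum (λ i → f i xor g i)    ≡⟨ ∑-distrib-+ f g ⟩
  sum f xor sum g            ≡⟨ ≡.sym (cong₂ _xor_ (sumF₂≡sum f) (sumF₂≡sum g)) ⟩
  sumF₂ f xor sumF₂ g        ∎
  where open ≡-Reasoning

∧-sumF₂ : ∀ {n} x (f : Fin n → F₂) → x ∧ sumF₂ f ≡ sumF₂ (λ i → x ∧ f i)
∧-sumF₂ x f = begin
  x ∧ sumF₂ f                ≡⟨ cong (x ∧_) (sumF₂≡sum f) ⟩
  x ∧ sum f                  ≡⟨ *-distribˡ-sum x f ⟩
  sum (λ i → x ∧ f i)        ≡⟨ ≡.sym (sumF₂≡sum (λ i → x ∧ f i)) ⟩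
  sumF₂ (λ i → x ∧ f i)      ∎
  where open ≡-Reasoning

sumF₂-∧ : ∀ {n} x (f : Fin n → F₂) → sumF₂ f ∧ x ≡ sumF₂ (λ i → f i ∧ x)
sumF₂-∧ x f = begin
  sumF₂ f ∧ x                ≡⟨ cong (_∧ x) (sumF₂≡sum f) ⟩
  sum f ∧ x                  ≡⟨ *-distribʳ-sum x f ⟩
  sum (λ i → f i ∧ x)        ≡⟨ ≡.sym (sumF₂≡sum (λ i → f i ∧ x)) ⟩
  sumF₂ (λ i → f i ∧ x)      ∎
  where open ≡-Reasoning

sumF₂-comm : ∀ {m n} (f : Fin m → Fin n → F₂) →
  sumF₂ (λ i → sumF₂ (λ j → f i j)) ≡ sumF₂ (λ j → sumF₂ (λ i → f i j))
sumF₂-comm f = begin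
  sumF₂ (λ i → sumF₂ (λ j → f i j))  ≡⟨ nested f ⟩
  sum (λ i → sum (λ j → f i j))      ≡⟨ ∑-comm f ⟩
  sum (λ j → sum (λ i → f i j))      ≡⟨ ≡.sym (nested (λ j i → f i j)) ⟩
  sumF₂ (λ j → sumF₂ (λ i → f i j))  ∎
  where
  open ≡-Reasoning
  nested : ∀ {m n} (g : Fin m → Fin n → F₂) → sumF₂ (λ i → sumF₂ (g i)) ≡ sum (λ i → sum (g i))
  nested g = ≡.trans (sumF₂≡sum (λ i → sumF₂ (g i))) (sum-cong-≗ (λ i → sumF₂≡sum (g i)))

sumF₂-unitˡ : ∀ {n} (i : Fin n) (f : Fin n → F₂) → sumF₂ (λ l → Iᴹ i l ∧ f l) ≡ f i
sumF₂-unitˡ {suc n} zero    f =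
  ≡.trans (cong (f zero xor_) (≡.sym (∧-sumF₂ false (f ∘ suc)))) (xor-identityʳ (f zero))
sumF₂-unitˡ {suc n} (suc i) f = sumF₂-unitˡ i (f ∘ suc)

sumF₂-scaled-unitˡ : ∀ {n} x (i : Fin n) (f : Fin n → F₂) → sumF₂ (λ l → (x ∧ Iᴹ i l) ∧ f l) ≡ x ∧ f i
sumF₂-scaled-unitˡ x i f = begin
  sumF₂ (λ l → (x ∧ Iᴹ i l) ∧ f l)  ≡⟨ sumF₂-cong (λ l → ∧-assoc x (Iᴹ i l) (f l)) ⟩
  sumF₂ (λ l → x ∧ (Iᴹ i l ∧ f l))  ≡⟨ ≡.sym (∧-sumF₂ x (λ l → Iᴹ i l ∧ f l)) ⟩
  x ∧ sumF₂ (λ l → Iᴹ i l ∧ f l)    ≡⟨ cong (x ∧_) (sumF₂-unitˡ i f) ⟩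
  x ∧ f i                           ∎
  where open ≡-Reasoning

sumF₂-true : ∀ {n} (f : Fin n → F₂) → sumF₂ f ≡ true → ∃ λ l → f l ≡ true
sumF₂-true {suc n} f sum≡true with f zero in f0≡true
... | true  = zero , f0≡true
... | false with sumF₂-true (f ∘ suc) sum≡true
...   | l , fl≡true = suc l , fl≡true

sumF₂-unitʳ : ∀ {n} (j : Fin n) (f : Fin n → F₂) → sumF₂ (λ l → f l ∧ Iᴹ l j) ≡ f j
sumF₂-unitʳ {suc n} zero    f = begin
  (f zero ∧ true) xor sumF₂ (λ l → f (suc l) ∧ false)
    ≡⟨ cong₂ _xor_ (∧-identityʳ (f zero)) (≡.sym (sumF₂-∧ false (f ∘ suc))) ⟩
  f zero xor (sumF₂ (f ∘ suc) ∧ false)                ≡⟨ cong (f zero xor_) (∧-zeroʳ _) ⟩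
  f zero xor false                                    ≡⟨ xor-identityʳ (f zero) ⟩
  f zero                                              ∎
  where open ≡-Reasoning
sumF₂-unitʳ {suc n} (suc j) f =
  ≡.trans (cong (_xor sumF₂ (λ l → f (suc l) ∧ Iᴹ l j)) (∧-zeroʳ (f zero))) (sumF₂-unitʳ j (f ∘ suc))

infix 4 _≈ᴹ_
_≈ᴹ_ : ∀ {n} → Mat n → Mat n → Set
A ≈ᴹ B = ∀ i j → A i j ≡ B i j

0ᴹ : ∀ {n} → Mat n
0ᴹ i j = false

module _ {n : ℕ} where

  *ᴹ-cong : {A A′ B B′ : Mat n} → A ≈ᴹ A′ → B ≈ᴹ B′ → A *ᴹ B ≈ᴹ A′ *ᴹ B′
  *ᴹ-cong A≈A′ B≈B′ i j = sumF₂-cong (λ l → cong₂ _∧_ (A≈A′ i l) (B≈B′ l j))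

  *ᴹ-assoc : (A B C : Mat n) → (A *ᴹ B) *ᴹ C ≈ᴹ A *ᴹ (B *ᴹ C)
  *ᴹ-assoc A B C i j = begin
    sumF₂ (λ l → sumF₂ (λ m → A i m ∧ B m l) ∧ C l j)
      ≡⟨ sumF₂-cong (λ l → sumF₂-∧ (C l j) (λ m → A i m ∧ B m l)) ⟩
    sumF₂ (λ l → sumF₂ (λ m → (A i m ∧ B m l) ∧ C l j))
      ≡⟨ sumF₂-comm (λ l m → (A i m ∧ B m l) ∧ C l j) ⟩
    sumF₂ (λ m → sumF₂ (λ l → (A i m ∧ B m l) ∧ C l j))
      ≡⟨ sumF₂-cong (λ m → sumF₂-cong (λ l → ∧-assoc (A i m) (B m l) (C l j))) ⟩
    sumF₂ (λ m → sumF₂ (λ l → A i m ∧ (B m l ∧ C l j)))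
      ≡⟨ sumF₂-cong (λ m → ≡.sym (∧-sumF₂ (A i m) (λ l → B m l ∧ C l j))) ⟩
    sumF₂ (λ m → A i m ∧ sumF₂ (λ l → B m l ∧ C l j))
      ∎
    where open ≡-Reasoning

  *ᴹ-identityˡ : (A : Mat n) → Iᴹ *ᴹ A ≈ᴹ A
  *ᴹ-identityˡ A i j = sumF₂-unitˡ i (λ l → A l j)

  *ᴹ-identityʳ : (A : Mat n) → A *ᴹ Iᴹ ≈ᴹ A
  *ᴹ-identityʳ A i j = sumF₂-unitʳ j (A i)

  *ᴹ-distribˡ : (A B C : Mat n) → A *ᴹ (B +ᴹ C) ≈ᴹ (A *ᴹ B) +ᴹ (A *ᴹ C)
  *ᴹ-distribˡ A B C i j = ≡.trans (sumF₂-cong (λ l → ∧-distribˡ-xor (A i l) (B l j) (C l j)))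
                                  (sumF₂-xor (λ l → A i l ∧ B l j) (λ l → A i l ∧ C l j))

  *ᴹ-distribʳ : (C A B : Mat n) → (A +ᴹ B) *ᴹ C ≈ᴹ (A *ᴹ C) +ᴹ (B *ᴹ C)
  *ᴹ-distribʳ C A B i j = ≡.trans (sumF₂-cong (λ l → ∧-distribʳ-xor (C l j) (A i l) (B i l)))
                                  (sumF₂-xor (λ l → A i l ∧ C l j) (λ l → B i l ∧ C l j))

  *ᴹ-zeroˡ : (A : Mat n) → 0ᴹ *ᴹ A ≈ᴹ 0ᴹ
  *ᴹ-zeroˡ A i j = ≡.sym (∧-sumF₂ false (λ l → A l j))

  *ᴹ-zeroʳ : (A : Mat n) → A *ᴹ 0ᴹ ≈ᴹ 0ᴹ
  *ᴹ-zeroʳ A i j = ≡.trans (≡.sym (sumF₂-∧ false (A i))) (∧-zeroʳ (sumF₂ (A i)))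

Mat-semiring : ℕ → Semiring 0ℓ 0ℓ
Mat-semiring n = record
  { Carrier = Mat n
  ; _≈_ = _≈ᴹ_
  ; _+_ = _+ᴹ_
  ; _*_ = _*ᴹ_
  ; 0# = 0ᴹ
  ; 1# = Iᴹ
  ; isSemiring = record
    { isSemiringWithoutAnnihilatingZero = record
      { +-isCommutativeMonoid = Entrywise.isCommutativeMonoid (Entrywise.isCommutativeMonoid xor-isCommutativeMonoid)
      ; *-cong = *ᴹ-cong
      ; *-assoc = *ᴹ-assoc
      ; *-identity = *ᴹ-identityˡ , *ᴹ-identityʳ
      ; distrib = *ᴹ-distribˡ , *ᴹ-distribʳ
      }
    ; zero = *ᴹ-zeroˡ , *ᴹ-zeroʳ
    }
  }
  where
  module Entrywise = Pointwise (Fin n)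
  open CommutativeRing xor-∧-commutativeRing using () renaming (+-isCommutativeMonoid to xor-isCommutativeMonoid)

+ᴹ-self : ∀ {n} (A : Mat n) → A +ᴹ A ≈ᴹ 0ᴹ
+ᴹ-self A i j = xor-same (A i j)

does-true⇒ : ∀ {p} {P : Set p} (P? : Dec P) → does P? ≡ true → P
does-true⇒ (yes p) _ = p

Iᴹ-diagonal : ∀ {n} (i : Fin n) → Iᴹ i i ≡ true
Iᴹ-diagonal zero    = refl
Iᴹ-diagonal (suc i) = Iᴹ-diagonal i

Iᴹ-off-diagonal : ∀ {n} {i j : Fin n} → i ≢ j → Iᴹ i j ≡ false
Iᴹ-off-diagonal {i = zero}  {zero}  i≢j = contradiction refl i≢j
Iᴹ-off-diagonal {i = zero}  {suc j} i≢j = refl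
Iᴹ-off-diagonal {i = suc i} {zero}  i≢j = refl
Iᴹ-off-diagonal {i = suc i} {suc j} i≢j = Iᴹ-off-diagonal (i≢j ∘ cong suc)

count : ∀ {n} → (Fin n → Bool) → ℕ
count {zero}  f = 0
count {suc n} f = (if f zero then 1 else 0) ℕ.+ count (f ∘ suc)

indicator-mono : ∀ {x y} → x Bool.≤ y → (if x then 1 else 0) ≤ (if y then 1 else 0)
indicator-mono Bool.f≤t = z≤n
indicator-mono Bool.b≤b = ℕₚ.≤-refl

indicator-mono-< : ∀ {x y} → x Bool.< y → (if x then 1 else 0) < (if y then 1 else 0)
indicator-mono-< Bool.f<t = s≤s z≤n

count-mono : ∀ {n} {f g : Fin n → Bool} → (∀ a → f a Bool.≤ g a) → count f ≤ count g
count-mono {zero}  f≤g = z≤n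
count-mono {suc n} f≤g = ℕₚ.+-mono-≤ (indicator-mono (f≤g zero)) (count-mono (f≤g ∘ suc))

count-mono-< : ∀ {n} {f g : Fin n → Bool} → (∀ a → f a Bool.≤ g a) → ∀ i → f i Bool.< g i → count f < count g
count-mono-< f≤g zero    fi<gi = ℕₚ.+-mono-<-≤ (indicator-mono-< fi<gi) (count-mono (f≤g ∘ suc))
count-mono-< f≤g (suc i) fi<gi = ℕₚ.+-mono-≤-< (indicator-mono (f≤g zero)) (count-mono-< (f≤g ∘ suc) i fi<gi)

module _ {n : ℕ} where
  open Semiring (Mat-semiring n) using () renaming (trans to ≈ᴹ-trans; sym to ≈ᴹ-sym; +-cong to +ᴹ-cong)
  open import Algebra.Properties.Semiring.Exp (Mat-semiring n) using (_^_; ^-congˡ)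
  open SemiringPowers (Mat-semiring n)
  open CharacteristicTwoProperties (Mat-semiring n) +ᴹ-self

  ^ᴹ≡^ : (A : Mat n) (k : ℕ) → A ^ᴹ k ≡ A ^ k
  ^ᴹ≡^ A zero    = refl
  ^ᴹ≡^ A (suc k) = cong (A *ᴹ_) (^ᴹ≡^ A k)

  descent-by-potential : (M : Mat n) (φ : Fin n → ℕ) → (∀ i j → M i j ≡ true → φ j < φ i) →
    ∀ p i j → (M ^ p) i j ≡ true → φ j ℕ.+ p ≤ φ i
  descent-by-potential M φ decreasing zero i j Iij≡true with i Fin.≟ j
  ... | yes refl = ℕₚ.≤-reflexive (ℕₚ.+-identityʳ (φ i))
  ... | no i≢j   = contradiction (≡.trans (≡.sym (Iᴹ-off-diagonal i≢j)) Iij≡true) λ ()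
  descent-by-potential M φ decreasing (suc p) i j Mᵖ⁺¹ij≡true
    with sumF₂-true (λ l → M i l ∧ (M ^ p) l j) Mᵖ⁺¹ij≡true
  ... | l , path = ≡.subst (_≤ φ i) (≡.sym (ℕₚ.+-suc (φ j) p))
                     (ℕₚ.≤-<-trans (descent-by-potential M φ decreasing p l j (∧-conicalʳ _ _ path))
                                   (decreasing i l (∧-conicalˡ _ _ path)))

  nilpotent-by-potential : (M : Mat n) (φ : Fin n → ℕ) → (∀ i j → M i j ≡ true → φ j < φ i) →
    ∀ p → (∀ i → φ i < p) → M ^ p ≈ᴹ 0ᴹ
  nilpotent-by-potential M φ decreasing p φ<p i j with (M ^ p) i j in Mᵖij
  ... | false = refl
  ... | true  = contradiction
    (ℕₚ.≤-<-trans (ℕₚ.≤-trans (ℕₚ.m≤n+m p (φ j)) (descent-by-potential M φ decreasing p i j Mᵖij)) (φ<p i))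
    (ℕₚ.<-irrefl refl)

  diag : (Fin n → F₂) → Mat n
  diag d i j = d i ∧ Iᴹ i j

  diag-*ˡ : ∀ d (M : Mat n) i j → (diag d *ᴹ M) i j ≡ d i ∧ M i j
  diag-*ˡ d M i j = sumF₂-scaled-unitˡ (d i) i (λ l → M l j)

  *-diagʳ : ∀ d (M : Mat n) i j → (M *ᴹ diag d) i j ≡ M i j ∧ d j
  *-diagʳ d M i j = ≡.trans (sumF₂-cong (λ l → ≡.sym (∧-assoc (M i l) (d l) (Iᴹ l j))))
                            (sumF₂-unitʳ j (λ l → M i l ∧ d l))

  diag-idempotent : ∀ d → diag d *ᴹ diag d ≈ᴹ diag d
  diag-idempotent d i j = begin
    (diag d *ᴹ diag d) i j  ≡⟨ diag-*ˡ d (diag d) i j ⟩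
    d i ∧ (d i ∧ Iᴹ i j)    ≡⟨ ≡.sym (∧-assoc (d i) (d i) (Iᴹ i j)) ⟩
    (d i ∧ d i) ∧ Iᴹ i j    ≡⟨ cong (_∧ Iᴹ i j) (∧-idem (d i)) ⟩
    d i ∧ Iᴹ i j            ∎
    where open ≡-Reasoning

  matrix-unit : Fin n → Fin n → Mat n
  matrix-unit i j a b = Iᴹ a i ∧ Iᴹ j b

  matrix-unit-*ˡ : ∀ i j (M : Mat n) a b → (matrix-unit i j *ᴹ M) a b ≡ Iᴹ a i ∧ M j b
  matrix-unit-*ˡ i j M a b = sumF₂-scaled-unitˡ (Iᴹ a i) j (λ l → M l b)

  *-matrix-unitʳ : ∀ i j (M : Mat n) a b → (M *ᴹ matrix-unit i j) a b ≡ M a i ∧ Iᴹ j b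
  *-matrix-unitʳ i j M a b = begin
    sumF₂ (λ l → M a l ∧ (Iᴹ l i ∧ Iᴹ j b))  ≡⟨ sumF₂-cong (λ l → ≡.sym (∧-assoc (M a l) (Iᴹ l i) (Iᴹ j b))) ⟩
    sumF₂ (λ l → (M a l ∧ Iᴹ l i) ∧ Iᴹ j b)  ≡⟨ ≡.sym (sumF₂-∧ (Iᴹ j b) (λ l → M a l ∧ Iᴹ l i)) ⟩
    sumF₂ (λ l → M a l ∧ Iᴹ l i) ∧ Iᴹ j b    ≡⟨ cong (_∧ Iᴹ j b) (sumF₂-unitʳ i (M a)) ⟩
    M a i ∧ Iᴹ j b                           ∎
    where open ≡-Reasoning

  matrix-unit-square-zero : ∀ {i j} → i ≢ j → matrix-unit i j *ᴹ matrix-unit i j ≈ᴹ 0ᴹ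
  matrix-unit-square-zero {i} {j} i≢j a b = begin
    (matrix-unit i j *ᴹ matrix-unit i j) a b  ≡⟨ matrix-unit-*ˡ i j (matrix-unit i j) a b ⟩
    Iᴹ a i ∧ (Iᴹ j i ∧ Iᴹ j b)                ≡⟨ cong (λ x → Iᴹ a i ∧ (x ∧ Iᴹ j b)) (Iᴹ-off-diagonal (i≢j ∘ ≡.sym)) ⟩
    Iᴹ a i ∧ false                            ≡⟨ ∧-zeroʳ (Iᴹ a i) ⟩
    false                                     ∎
    where open ≡-Reasoning

  LinkedOnes : Mat n → Set
  LinkedOnes C = ∃₂ λ i j → i ≢ j × C i i ≡ true × C j j ≡ true × C i j ≡ true

  linkedOnes? : (C : Mat n) → Dec (LinkedOnes C)
  linkedOnes? C = any? λ i → any? λ j →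
    ¬? (i Fin.≟ j) ×-dec C i i Bool.≟ true ×-dec C j j Bool.≟ true ×-dec C i j Bool.≟ true

  module NoLinkedOnes (C : Mat n) (unlinked : ¬ LinkedOnes C) where

    key : Fin n → ℕ
    key i = if C i i then 0 else suc (toℕ i)

    zero-on-diagonal : Fin n → Bool
    zero-on-diagonal i = not (C i i)

    upper lower D : Mat n
    upper i j = C i j ∧ does (key i <? key j)
    lower i j = C i j ∧ does (key j <? key i)
    D = diag zero-on-diagonal

    key≤n : ∀ i → key i ≤ n
    key≤n i with C i i
    ... | true  = z≤n
    ... | false = toℕ<n i

    key-collision : ∀ {i j} → i ≢ j → key i ≡ key j → C i i ≡ true × C j j ≡ true
    key-collision {i} {j} i≢j keys≡ with C i i | C j j
    ... | true  | true  = refl , refl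
    ... | true  | false = contradiction keys≡ λ ()
    ... | false | true  = contradiction keys≡ λ ()
    ... | false | false = contradiction (toℕ-injective (ℕₚ.suc-injective keys≡)) i≢j

    upper-increasing : ∀ {i j} → upper i j ≡ true → key i < key j
    upper-increasing {i} {j} = does-true⇒ (key i <? key j) ∘ ∧-conicalʳ (C i j) _

    lower-decreasing : ∀ {i j} → lower i j ≡ true → key j < key i
    lower-decreasing {i} {j} = does-true⇒ (key j <? key i) ∘ ∧-conicalʳ (C i j) _

    upper-diagonal : ∀ i → upper i i ≡ false
    upper-diagonal i = ≡.trans (cong (C i i ∧_) (dec-false (key i <? key i) (ℕₚ.<-irrefl refl))) (∧-zeroʳ (C i i))

    equal-keys⇒no-entry : ∀ {i j} → i ≢ j → key i ≡ key j → C i j ≡ false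
    equal-keys⇒no-entry i≢j keys≡ with key-collision i≢j keys≡
    ... | cii , cjj = ¬-not λ cij → unlinked (_ , _ , i≢j , cii , cjj , cij)

    upper-xor-lower : ∀ {i j} → i ≢ j → upper i j xor lower i j ≡ C i j
    upper-xor-lower {i} {j} i≢j with ℕₚ.<-cmp (key i) (key j)
    ... | tri< i<j _ j≮i rewrite dec-true (key i <? key j) i<j | dec-false (key j <? key i) j≮i
                               | ∧-identityʳ (C i j) | ∧-zeroʳ (C i j) = xor-identityʳ (C i j)
    ... | tri> i≮j _ j<i rewrite dec-false (key i <? key j) i≮j | dec-true (key j <? key i) j<i
                               | ∧-identityʳ (C i j) | ∧-zeroʳ (C i j) = refl
    ... | tri≈ i≮j keys≡ j≮i rewrite dec-false (key i <? key j) i≮j | dec-false (key j <? key i) j≮i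
                                   | ∧-zeroʳ (C i j) = ≡.sym (equal-keys⇒no-entry i≢j keys≡)

    split : C ≈ᴹ (Iᴹ +ᴹ upper) +ᴹ (D +ᴹ lower)
    split i j with i Fin.≟ j
    ... | yes refl rewrite Iᴹ-diagonal i | upper-diagonal i = diagonal-entry (C i i)
      where diagonal-entry : ∀ c → c ≡ (true xor false) xor ((not c ∧ true) xor false)
            diagonal-entry true  = refl
            diagonal-entry false = refl
    ... | no i≢j rewrite Iᴹ-off-diagonal i≢j | ∧-zeroʳ (not (C i i)) = ≡.sym (upper-xor-lower i≢j)

    lower-row-vanishes : ∀ {i} j → C i i ≡ true → lower i j ≡ false
    lower-row-vanishes {i} j cii = ≡.trans (cong (C i j ∧_) (dec-false (key j <? key i) j≮0)) (∧-zeroʳ (C i j))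
      where j≮0 : ¬ key j < key i
            j≮0 = ℕₚ.n≮0 ∘ ≡.subst (key j <_) (cong (λ b → if b then 0 else suc (toℕ i)) cii)

    D-*-lower : D *ᴹ lower ≈ᴹ lower
    D-*-lower i j = ≡.trans (diag-*ˡ zero-on-diagonal lower i j) (absorb (lower-row-vanishes j))
      where absorb : ∀ {c x} → (c ≡ true → x ≡ false) → not c ∧ x ≡ x
            absorb {true}  c⇒x≡false = ≡.sym (c⇒x≡false refl)
            absorb {false} c⇒x≡false = refl

    upper-nilpotent : upper ^ (2 ℕ.^ n) ≈ᴹ 0ᴹ
    upper-nilpotent = nilpotent-by-potential upper (λ i → n ℕ.∸ key i)
      (λ i j uij → ℕₚ.∸-monoʳ-< (upper-increasing uij) (key≤n j)) (2 ℕ.^ n)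
      (λ i → ℕₚ.≤-<-trans (ℕₚ.m∸n≤m n (key i)) (n<2^n n))

    lower-*-D-nilpotent : (lower *ᴹ D) ^ (2 ℕ.^ n) ≈ᴹ 0ᴹ
    lower-*-D-nilpotent = nilpotent-by-potential (lower *ᴹ D) key
      (λ i j LDij≡true → lower-decreasing (∧-conicalˡ _ _ (≡.trans (≡.sym (*-diagʳ _ lower i j)) LDij≡true))) (2 ℕ.^ n)
      (λ i → ℕₚ.≤-<-trans (key≤n i) (n<2^n n))

    I+upper-periodic : (Iᴹ +ᴹ upper) ^ suc (2 ℕ.^ n) ≈ᴹ Iᴹ +ᴹ upper
    I+upper-periodic = idempotent+nilpotent-periodic n (*ᴹ-identityˡ Iᴹ) (*ᴹ-identityˡ upper)
      (≈ᴹ-trans (^-congˡ (2 ℕ.^ n) (*ᴹ-identityʳ upper)) upper-nilpotent)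

    D+lower-periodic : (D +ᴹ lower) ^ suc (2 ℕ.^ n) ≈ᴹ D +ᴹ lower
    D+lower-periodic =
      idempotent+nilpotent-periodic n (diag-idempotent zero-on-diagonal) D-*-lower lower-*-D-nilpotent

    unlinked-decomposable : ∀ k → OddPos k → SumOfTwoPowers k C
    unlinked-decomposable k odd
      with odd-root-of-2^-periodic n I+upper-periodic k odd | odd-root-of-2^-periodic n D+lower-periodic k odd
    ... | x , xᵏ≈I+upper | y , yᵏ≈D+lower = x , y , ≈ᴹ-trans split (+ᴹ-cong (≈ᴹ-sym xᵏ≈I+upper) (≈ᴹ-sym yᵏ≈D+lower))

  module Transvection (C : Mat n) {i j : Fin n} (i≢j : i ≢ j)
                      (cii : C i i ≡ true) (cjj : C j j ≡ true) (cij : C i j ≡ true) where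

    T C′ : Mat n
    T = Iᴹ +ᴹ matrix-unit j i
    C′ = (T *ᴹ C) *ᴹ T

    T-involutive : T *ᴹ T ≈ᴹ Iᴹ
    T-involutive = square-zero-transvection-involutive (matrix-unit-square-zero (i≢j ∘ ≡.sym))

    T-*ˡ : ∀ (M : Mat n) a b → (T *ᴹ M) a b ≡ M a b xor (Iᴹ a j ∧ M i b)
    T-*ˡ M a b = ≡.trans (*ᴹ-distribʳ M Iᴹ (matrix-unit j i) a b)
                         (cong₂ _xor_ (*ᴹ-identityˡ M a b) (matrix-unit-*ˡ j i M a b))

    *-Tʳ : ∀ (M : Mat n) a b → (M *ᴹ T) a b ≡ M a b xor (M a j ∧ Iᴹ i b)
    *-Tʳ M a b = ≡.trans (*ᴹ-distribˡ M Iᴹ (matrix-unit j i) a b)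
                         (cong₂ _xor_ (*ᴹ-identityʳ M a b) (*-matrix-unitʳ j i M a b))

    C′-diagonal : ∀ a → C′ a a ≡ (C a a xor (Iᴹ a j ∧ C i a)) xor ((C a j xor (Iᴹ a j ∧ C i j)) ∧ Iᴹ i a)
    C′-diagonal a = ≡.trans (*-Tʳ (T *ᴹ C) a a) (cong₂ (λ x y → x xor (y ∧ Iᴹ i a)) (T-*ˡ C a a) (T-*ˡ C a j))

    C′ii≡false : C′ i i ≡ false
    C′ii≡false rewrite C′-diagonal i | Iᴹ-off-diagonal i≢j | Iᴹ-diagonal i | cii | cij = refl

    C′-diagonal-elsewhere : ∀ {a} → a ≢ i → a ≢ j → C′ a a ≡ C a a
    C′-diagonal-elsewhere {a} a≢i a≢j
      rewrite C′-diagonal a | Iᴹ-off-diagonal a≢j | Iᴹ-off-diagonal (a≢i ∘ ≡.sym)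
            | ∧-zeroʳ (C a j xor false) | xor-identityʳ (C a a xor false) = xor-identityʳ (C a a)

    C′-diagonal-≤ : ∀ a → C′ a a Bool.≤ C a a
    C′-diagonal-≤ a with a Fin.≟ i | a Fin.≟ j
    ... | yes refl | _        = ≡.subst (Bool._≤ C a a) (≡.sym C′ii≡false) (≤-minimum (C a a))
    ... | no _     | yes refl = ≡.subst (C′ a a Bool.≤_) (≡.sym cjj) (≤-maximum (C′ a a))
    ... | no a≢i   | no a≢j   = ≤-reflexive (C′-diagonal-elsewhere a≢i a≢j)

    diagonal-count-decreases : count (λ a → C′ a a) < count (λ a → C a a)
    diagonal-count-decreases =
      count-mono-< C′-diagonal-≤ i (≡.subst₂ Bool._<_ (≡.sym C′ii≡false) (≡.sym cii) Bool.f<t)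

  decomposable-below : ∀ k → OddPos k → ∀ b (C : Mat n) → count (λ a → C a a) < b → SumOfTwoPowers k C
  decomposable-below k odd (suc b) C count<b with linkedOnes? C
  ... | no unlinked = NoLinkedOnes.unlinked-decomposable C unlinked k odd
  ... | yes (i , j , i≢j , cii , cjj , cij) =
    SumOfTwoPowers-conj T-involutive T-involutive k C
      (decomposable-below k odd b C′ (ℕₚ.<-≤-trans diagonal-count-decreases (ℕₚ.≤-pred count<b)))
    where open Transvection C i≢j cii cjj cij

  decomposable : ∀ k → OddPos k → (C : Mat n) → SumOfTwoPowers k C
  decomposable k odd C = decomposable-below k odd (suc (count (λ a → C a a))) C ℕₚ.≤-refl

theorem1p4 : (n k : ℕ) → 2 ≤ n → OddPos k →
    (C : Mat n) → ∃₂ λ (A B : Mat n) → ∀ i j → C i j ≡ ((A ^ᴹ k) +ᴹ (B ^ᴹ k)) i j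
theorem1p4 n k _ odd C with decomposable k odd C
... | A , B , C≈Aᵏ+Bᵏ =
  A , B , λ i j → ≡.trans (C≈Aᵏ+Bᵏ i j) (≡.sym (cong₂ (λ X Y → (X +ᴹ Y) i j) (^ᴹ≡^ A k) (^ᴹ≡^ B k)))
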